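{- Let $P$ be an $n$-element poset, and let $\mathcal M$ be the set of maximal elements of $P$. For each $x\in\mathcal M$, let $\mathscr C_x$ be the number of chains of $P$ that contain $x$. Then the number of sortable labelings of $P$ is \[\sum_{x\in\mathcal M}\mathscr C_x\,|\mathcal L(P\setminus\{x\})|.\]
   Context: A labeling of an $n$-element poset $P$ is a bijection $L:P\to[n]$; $\mathcal L(R)$ denotes the set of linear extensions of a finite poset $R$ (bijections $L:R\to[|R|]$ with $L(x)\le L(y)$ whenever $x\le_R y$), and $P\setminus\{x\}$ is the induced subposet. A chain is a totally ordered subset. For a labeling $L$ and a non-maximal $x$, the $L$-successor of $x$ is the element $y>_P x$ minimizing $L(y)$. The promotion chain of $L$ is $v_1<_P\cdots<_P v_m$ with $v_1=L^{ -1}(1)$, $v_{i+1}$ the $L$-successor of $v_i$ while $v_i$ is not maximal, and $v_m$ maximal. Extended promotion: $\partial(L)(x)=L(x)-1$ for $x$ not in the chain, $\partial(L)(v_i)=L(v_{i+1})-1$ for $i<m$, $\partial(L)(v_m)=n$. A labeling $L$ is sortable if $\partial(L)$ is a linear extension of $P$. -}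

module Defs where

open import Level using (0ℓ)
open import Data.Nat using (ℕ; zero; suc; _∸_; _≤_; _≤?_; _*_)
open import Data.Nat.Properties using () renaming (_≟_ to _≟ℕ_)
open import Data.Fin using (Fin; toℕ; punchIn)
open import Data.Fin.Properties using (all?; any?; _≟_)
open import Data.Fin.Subset using (Subset; _∈_; inside; outside)
open import Data.Fin.Subset.Properties using (_∈?_)
open import Data.Vec using (Vec; []; _∷_; lookup)
open import Data.List using (List; []; _∷_; [_]; length; filter; map; concatMap; sum)
open import Data.List.Base using (allFin)
open import Data.Maybe using (Maybe; just; nothing; maybe; maybe′)
open import Data.Product using (_×_; ∃)
open import Data.Sum using (_⊎_)
open import Relation.Binary using (Rel; IsPartialOrder)
import Relation.Binary as B
open import Relation.Binary.PropositionalEquality using (_≡_; _≢_)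
open import Relation.Nullary using (Dec; yes; no; ¬_; does)
open import Relation.Nullary.Decidable using (_×-dec_; _→-dec_; _⊎-dec_; ¬?)
open import Relation.Unary using (Pred; Decidable)

-- Finite posets: an n-element poset is taken (up to isomorphism) to have
-- carrier Fin n, with a decidable partial order.

record FinPoset (n : ℕ) : Set₁ where
  field
    _≼_            : Rel (Fin n) 0ℓ
    _≼?_           : B.Decidable _≼_
    isPartialOrder : IsPartialOrder _≡_ _≼_

vecs : {A : Set} → List A → (k : ℕ) → List (Vec A k)
vecs xs zero    = [ [] ]
vecs xs (suc k) = concatMap (λ a → map (a ∷_) (vecs xs k)) xs

count : {A : Set} {Q : Pred A 0ℓ} → Decidable Q → List A → ℕ
count Q? xs = length (filter Q? xs)

-- Labelings.  A labeling of an m-element set (carrier Fin m) is a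
-- bijection onto [m] = {1,…,m}.  Maps Fin m → ℕ are used for label values
-- (1-indexed, as in the paper).

IsLabeling : (m : ℕ) → (Fin m → ℕ) → Set
IsLabeling m f =
  (∀ x → (1 ≤ f x) × (f x ≤ m))
  × (∀ x y → f x ≡ f y → x ≡ y)
  × (∀ (i : Fin m) → ∃ λ x → f x ≡ suc (toℕ i))

isLabeling? : (m : ℕ) (f : Fin m → ℕ) → Dec (IsLabeling m f)
isLabeling? m f =
  all? (λ x → (1 ≤? f x) ×-dec (f x ≤? m))
  ×-dec all? (λ x → all? (λ y → (f x ≟ℕ f y) →-dec (x ≟ y)))
  ×-dec all? (λ i → any? (λ x → f x ≟ℕ suc (toℕ i)))

IsLinearExtension : (m : ℕ) → Rel (Fin m) 0ℓ → (Fin m → ℕ) → Set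
IsLinearExtension m R f = IsLabeling m f × (∀ x y → R x y → f x ≤ f y)

isLinearExtension? : (m : ℕ) (R : Rel (Fin m) 0ℓ) → B.Decidable R →
                     (f : Fin m → ℕ) → Dec (IsLinearExtension m R f)
isLinearExtension? m R R? f =
  isLabeling? m f ×-dec all? (λ x → all? (λ y → R? x y →-dec (f x ≤? f y)))

-- Every map Fin m → [m] is encoded exactly once by a vector
-- V : Vec (Fin m) m, via x ↦ 1 + toℕ (lookup V x).
asMap : {m : ℕ} → Vec (Fin m) m → Fin m → ℕ
asMap V x = suc (toℕ (lookup V x))

allMaps : (m : ℕ) → List (Vec (Fin m) m)
allMaps m = vecs (allFin m) m

#linExt : (m : ℕ) (R : Rel (Fin m) 0ℓ) → B.Decidable R → ℕ
#linExt m R R? = count (λ V → isLinearExtension? m R R? (asMap V)) (allMaps m)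

module _ {n : ℕ} (P : FinPoset n) where
  open FinPoset P

  _≺_ : Rel (Fin n) 0ℓ
  x ≺ y = (x ≼ y) × (x ≢ y)

  _≺?_ : B.Decidable _≺_
  x ≺? y = (x ≼? y) ×-dec ¬? (x ≟ y)

  IsMaximal : Fin n → Set
  IsMaximal x = ∀ y → x ≼ y → x ≡ y

  isMaximal? : Decidable IsMaximal
  isMaximal? x = all? (λ y → (x ≼? y) →-dec (x ≟ y))

  IsChain : Subset n → Set
  IsChain S = ∀ a b → a ∈ S → b ∈ S → (a ≼ b) ⊎ (b ≼ a)

  IsChainContaining : Fin n → Subset n → Set
  IsChainContaining x S = (x ∈ S) × IsChain S

  isChainContaining? : (x : Fin n) → Decidable (IsChainContaining x)
  isChainContaining? x S =
    (x ∈? S) ×-dec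
    all? (λ a → all? (λ b → (a ∈? S) →-dec ((b ∈? S) →-dec ((a ≼? b) ⊎-dec (b ≼? a)))))

  #chainsContaining : Fin n → ℕ
  #chainsContaining x =
    count (isChainContaining? x) (vecs (inside ∷ outside ∷ []) n)

  module _ (ℓ : Fin n → ℕ) where

    argmin : List (Fin n) → Maybe (Fin n)
    argmin []       = nothing
    argmin (y ∷ ys) with argmin ys
    ... | nothing = just y
    ... | just z  with ℓ z Data.Nat.<? ℓ y
    ...   | yes _ = just z
    ...   | no  _ = just y

    successor : Fin n → Maybe (Fin n)
    successor x = argmin (filter (x ≺?_) (allFin n))

    inverse : ℕ → Maybe (Fin n)
    inverse i = argmin (filter (λ y → ℓ y ≟ℕ i) (allFin n))

    -- follow successors from x until reaching a maximal element.
    -- The fuel n bounds the length of any chain in an n-element poset,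
    -- so it never runs out before a maximal element is reached.
    chainFrom : ℕ → Fin n → List (Fin n)
    chainFrom zero     x = [ x ]
    chainFrom (suc k)  x with successor x
    ... | nothing = [ x ]
    ... | just y  = x ∷ chainFrom k y

    promotionChain : List (Fin n)
    promotionChain = maybe′ (chainFrom n) [] (inverse 1)

    onChainFrom : Fin n → List (Fin n) → Fin n → Maybe ℕ
    onChainFrom v []       x with x ≟ v
    ... | yes _ = just n                       -- ∂(ℓ)(v_m) = n
    ... | no  _ = nothing
    onChainFrom v (w ∷ vs) x with x ≟ v
    ... | yes _ = just (ℓ w ∸ 1)               -- ∂(ℓ)(v_i) = ℓ(v_{i+1}) - 1
    ... | no  _ = onChainFrom w vs x

    onChain : List (Fin n) → Fin n → Maybe ℕ
    onChain []       x = nothing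
    onChain (v ∷ vs) x = onChainFrom v vs x

    ∂ : Fin n → ℕ
    ∂ x = maybe′ (λ k → k) (ℓ x ∸ 1) (onChain promotionChain x)

  IsSortableLabeling : (Fin n → ℕ) → Set
  IsSortableLabeling ℓ = IsLabeling n ℓ × IsLinearExtension n _≼_ (∂ ℓ)

  isSortableLabeling? : Decidable IsSortableLabeling
  isSortableLabeling? ℓ = isLabeling? n ℓ ×-dec isLinearExtension? n _≼_ _≼?_ (∂ ℓ)

  #sortable : ℕ
  #sortable = count (λ V → isSortableLabeling? (asMap V)) (allMaps n)

-- induced subposet P ∖ {x} (x : Fin (suc m)), with carrier Fin m embedded
-- into Fin (suc m) by punchIn x (an order-preserving bijection onto
-- Fin (suc m) ∖ {x}).
_∖≼_ : {m : ℕ} (P : FinPoset (suc m)) (x : Fin (suc m)) → Rel (Fin m) 0ℓ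
(P ∖≼ x) a b = FinPoset._≼_ P (punchIn x a) (punchIn x b)

_∖≼?_ : {m : ℕ} (P : FinPoset (suc m)) (x : Fin (suc m)) → B.Decidable (P ∖≼ x)
(P ∖≼? x) a b = FinPoset._≼?_ P (punchIn x a) (punchIn x b)

#linExtDelete : {m : ℕ} (P : FinPoset (suc m)) (x : Fin (suc m)) → ℕ
#linExtDelete {m} P x = #linExt m (P ∖≼ x) (P ∖≼? x)

{-# OPTIONS --safe #-}
module Submission where

-- Sending a sortable labeling ℓ to (x, C, L), where C is the set of its promotion chain, x the last
-- element of that chain and L the restriction of ∂ℓ to P ∖ {x}, is a bijection onto the triples
-- with x maximal, C a chain through x and L ∈ 𝓛(P ∖ {x}).  Indeed ∂ℓ is a linear extension with
-- ∂ℓ(x) = n, so x is maximal and ∂ℓ is recovered from L; and ℓ is recovered from D = ∂ℓ and C: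
-- ℓ(y) = D(y) + 1 off C, while on C each label is one more than the D-value of the predecessor in
-- C (1 for the D-least element).  Conversely, for any linear extension D with top element x and
-- any chain C through x this recipe yields a labeling whose successors walk through C in D-order,
-- so its promotion chain is C and its promotion is D.

open import Defs
open import Level using (0ℓ)
open import Function using (id; _∘_; _⇔_; mk⇔)
open import Data.Empty using (⊥; ⊥-elim)
open import Data.Bool using (true; false)
open import Data.Product using (_×_; _,_; _,′_; ∃; ∃₂; proj₁; proj₂; uncurry)
open import Data.Sum using (_⊎_; inj₁; inj₂)
open import Data.Maybe using (Maybe; just; nothing; maybe′; fromMaybe)
open import Data.Nat using (ℕ; zero; suc; _+_; _*_; _∸_; _≤_; _<_; _<?_; z≤n; s≤s)
open import Data.Nat.Properties
  using ( ≤-refl; ≤-trans; ≤-antisym; ≤-pred; <-trans; <-irrefl; <-≤-trans; <⇒≤; ≮⇒≥; ≤∧≢⇒<; <-cmp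
        ; suc-injective; +-suc; +-monoʳ-≤; m≤m+n )
import Data.Nat.Properties as ℕ
open import Data.Nat.ListAction using (sum)
open import Data.Fin using (Fin; zero; suc; toℕ; fromℕ<; punchIn; punchOut; lower₁)
open import Data.Fin.Properties
  using ( _≟_; toℕ-fromℕ<; toℕ-injective; toℕ<n; toℕ-lower₁
        ; punchIn-punchOut; punchOut-punchIn; punchOut-cong; punchInᵢ≢i; punchIn-injective )
open import Data.Fin.Subset as Subset using (Subset; inside; outside; ⁅_⁆; _∪_)
  renaming (_∈_ to _∈ₛ_; _∉_ to _∉ₛ_)
open import Data.Fin.Subset.Properties using (⊆-antisym; x∈⁅x⁆; x∈⁅y⁆⇒x≡y; x∈p∪q⁺; x∈p∪q⁻; ∉⊥)
  renaming (_∈?_ to _∈ₛ?_)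
open import Data.Vec using (Vec; []; _∷_; lookup; tabulate)
open import Data.Vec.Properties using (lookup∘tabulate; tabulate∘lookup; tabulate-cong)
open import Data.List
  using (List; []; _∷_; [_]; _++_; _∷ʳ_; length; map; filter; concatMap; cartesianProduct; last)
open import Data.List.Base using (allFin)
open import Data.List.Properties
  using ( length-++; length-map; map-∘; map-id-local; map-cong; filter-≐; filter-none
        ; ∷-injective; ∷ʳ-injectiveʳ; ++-assoc )
open import Data.List.Extrema.Nat using (max; argmax-sel; xs≤max; max<v⁺; max≈v⁺)
open import Data.List.Membership.Propositional using (_∈_; _∉_; lose; find)
open import Data.List.Membership.Propositional.Properties
  using ( ∈-allFin; ∈-map⁺; ∈-map⁻; ∈-filter⁺; ∈-filter⁻; ∈-++⁺ˡ; ∈-++⁺ʳ; ∈-++⁻; ∈-∃++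
        ; ∈-concatMap⁺; ∈-concatMap⁻; ∈-cartesianProduct⁺; ∈-cartesianProduct⁻ )
open import Data.List.Membership.Propositional.Properties.WithK using (unique∧set⇒bag)
open import Data.List.Relation.Binary.BagAndSetEquality using (∼bag⇒↭)
open import Data.List.Relation.Binary.Permutation.Propositional.Properties using (↭-length)
open import Data.List.Relation.Unary.Any using (here; there)
import Data.List.Relation.Unary.All as All
import Data.List.Relation.Unary.All.Properties as All
open import Data.List.Relation.Unary.AllPairs as AllPairs using (AllPairs; []; _∷_)
open import Data.List.Relation.Unary.Linked as Linked using (Linked; []; [-]; _∷_)
open import Data.List.Relation.Unary.Linked.Properties using (Linked⇒AllPairs)
open import Data.List.Relation.Unary.Unique.Propositional using (Unique)
import Data.List.Relation.Unary.Unique.Propositional.Properties as Unique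
open import Relation.Binary using (Rel; IsPartialOrder; tri<; tri≈; tri>)
open import Relation.Binary.PropositionalEquality
  using (_≡_; _≢_; refl; sym; trans; cong; cong₂; subst; subst₂; module ≡-Reasoning)
open import Relation.Nullary using (¬_; Dec; yes; no)
open import Relation.Nullary.Decidable using (_×-dec_)
open import Relation.Unary using (Decidable)

private
  variable
    A B : Set

module _ (f : A → List B) where

  ∈-concatMap⁺′ : ∀ {xs a z} → a ∈ xs → z ∈ f a → z ∈ concatMap f xs
  ∈-concatMap⁺′ a∈xs z∈fa = ∈-concatMap⁺ f (lose a∈xs z∈fa)

  ∈-concatMap⁻′ : ∀ {xs z} → z ∈ concatMap f xs → ∃ λ a → a ∈ xs × z ∈ f a
  ∈-concatMap⁻′ z∈ = find (∈-concatMap⁻ f z∈)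

  length-concatMap : ∀ xs → length (concatMap f xs) ≡ sum (map (length ∘ f) xs)
  length-concatMap []       = refl
  length-concatMap (x ∷ xs) = trans (length-++ (f x)) (cong (length (f x) +_) (length-concatMap xs))

  concatMap⁺ : ∀ {xs} → Unique xs → (∀ a → Unique (f a)) →
               (∀ {a b z} → z ∈ f a → z ∈ f b → a ≡ b) → Unique (concatMap f xs)
  concatMap⁺ {[]}     []           _      _        = []
  concatMap⁺ {x ∷ xs} (x∉xs ∷ xs!) uniq-f disjoint =
    Unique.++⁺ (uniq-f x) (concatMap⁺ xs! uniq-f disjoint) separated
    where
    separated : ∀ {z} → ¬ (z ∈ f x × z ∈ concatMap f xs)
    separated (z∈fx , z∈rest) with ∈-concatMap⁻′ z∈rest
    ... | a , a∈xs , z∈fa = All.lookup x∉xs a∈xs (disjoint z∈fx z∈fa)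

length-cartesianProduct : ∀ (xs : List A) (ys : List B) →
                          length (cartesianProduct xs ys) ≡ length xs * length ys
length-cartesianProduct []       ys = refl
length-cartesianProduct (x ∷ xs) ys =
  trans (length-++ (map (x ,_) ys))
        (cong₂ _+_ (length-map (x ,_) ys) (length-cartesianProduct xs ys))

map⁺-retraction : ∀ {f : A → B} {g : B → A} {xs} →
                  All.All (λ a → g (f a) ≡ a) xs → Unique xs → Unique (map f xs)
map⁺-retraction {f = f} {g} {xs} g∘f≡id xs! =
  Unique.map⁻ (subst Unique (sym (trans (sym (map-∘ {g = g} {f} xs)) (map-id-local g∘f≡id))) xs!)

length-unique-≡ : ∀ {xs ys : List A} → Unique xs → Unique ys →
                  (∀ {z} → z ∈ xs ⇔ z ∈ ys) → length xs ≡ length ys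
length-unique-≡ xs! ys! same = ↭-length (∼bag⇒↭ (unique∧set⇒bag xs! ys! same))

vecs⁺ : ∀ {xs : List A} → Unique xs → ∀ k → Unique (vecs xs k)
vecs⁺ xs! zero    = All.[] ∷ []
vecs⁺ xs! (suc k) = concatMap⁺ _ xs! (λ _ → Unique.map⁺ ∷-injectiveʳ (vecs⁺ xs! k)) same-head
  where
  ∷-injectiveʳ : ∀ {a : A} {v w : Vec A k} → a ∷ v ≡ a ∷ w → v ≡ w
  ∷-injectiveʳ refl = refl
  same-head : ∀ {a b z} → z ∈ map (a ∷_) (vecs _ k) → z ∈ map (b ∷_) (vecs _ k) → a ≡ b
  same-head z∈ z∈′ with ∈-map⁻ _ z∈ | ∈-map⁻ _ z∈′
  ... | _ , _ , refl | _ , _ , refl = refl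

∈-vecs : ∀ {xs : List A} {k} (v : Vec A k) → (∀ i → lookup v i ∈ xs) → v ∈ vecs xs k
∈-vecs []      _    = here refl
∈-vecs (a ∷ v) all∈ = ∈-concatMap⁺′ _ (all∈ zero) (∈-map⁺ (a ∷_) (∈-vecs v (all∈ ∘ suc)))

module _ {R : Rel A 0ℓ} where

  AllPairs-++⁻ʳ : ∀ xs {ys} → AllPairs R (xs ++ ys) → AllPairs R ys
  AllPairs-++⁻ʳ []       pairs       = pairs
  AllPairs-++⁻ʳ (_ ∷ xs) (_ ∷ pairs) = AllPairs-++⁻ʳ xs pairs

  AllPairs-++-∈ : ∀ xs {ys a b} → AllPairs R (xs ++ ys) → a ∈ xs → b ∈ ys → R a b
  AllPairs-++-∈ (_ ∷ xs) (x~ ∷ _)    (here refl) b∈ = All.lookup x~ (∈-++⁺ʳ xs b∈)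
  AllPairs-++-∈ (_ ∷ xs) (_ ∷ pairs) (there a∈)  b∈ = AllPairs-++-∈ xs pairs a∈ b∈

  AllPairs-∈-total : ∀ {xs a b} → AllPairs R xs → a ∈ xs → b ∈ xs → a ≡ b ⊎ R a b ⊎ R b a
  AllPairs-∈-total (_ ∷ _)     (here refl) (here refl) = inj₁ refl
  AllPairs-∈-total (x~ ∷ _)    (here refl) (there b∈)  = inj₂ (inj₁ (All.lookup x~ b∈))
  AllPairs-∈-total (x~ ∷ _)    (there a∈)  (here refl) = inj₂ (inj₂ (All.lookup x~ a∈))
  AllPairs-∈-total (_ ∷ pairs) (there a∈)  (there b∈)  = AllPairs-∈-total pairs a∈ b∈

  Linked-adjacent : ∀ xs {a b ys} → Linked R (xs ++ a ∷ b ∷ ys) → R a b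
  Linked-adjacent []           (Rab ∷ _)    = Rab
  Linked-adjacent (_ ∷ [])     (_ ∷ linked) = Linked-adjacent [] linked
  Linked-adjacent (_ ∷ y ∷ xs) (_ ∷ linked) = Linked-adjacent (y ∷ xs) linked

last-∷ʳ : ∀ (xs : List A) x → last (xs ∷ʳ x) ≡ just x
last-∷ʳ []           x = refl
last-∷ʳ (_ ∷ [])     x = refl
last-∷ʳ (_ ∷ y ∷ ys) x = last-∷ʳ (y ∷ ys) x

∷-∷ʳ : ∀ (y : A) ys → ∃₂ λ pre x → y ∷ ys ≡ pre ∷ʳ x
∷-∷ʳ y []       = [] , y , refl
∷-∷ʳ y (z ∷ zs) = let pre , x , z∷zs≡ = ∷-∷ʳ z zs in y ∷ pre , x , cong (y ∷_) z∷zs≡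

[]≢++∷ : ∀ (xs : List A) {y ys} → [] ≢ xs ++ y ∷ ys
[]≢++∷ []      ()
[]≢++∷ (_ ∷ _) ()

fromList : ∀ {n} → List (Fin n) → Subset n
fromList []       = Subset.⊥
fromList (x ∷ xs) = ⁅ x ⁆ ∪ fromList xs

∈-fromList⁺ : ∀ {n} {x : Fin n} {xs} → x ∈ xs → x ∈ₛ fromList xs
∈-fromList⁺ (here refl) = x∈p∪q⁺ (inj₁ (x∈⁅x⁆ _))
∈-fromList⁺ (there x∈)  = x∈p∪q⁺ (inj₂ (∈-fromList⁺ x∈))

∈-fromList⁻ : ∀ {n} {x : Fin n} xs → x ∈ₛ fromList xs → x ∈ xs
∈-fromList⁻ []       x∈ = ⊥-elim (∉⊥ x∈)
∈-fromList⁻ (y ∷ ys) x∈ with x∈p∪q⁻ ⁅ y ⁆ (fromList ys) x∈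
... | inj₁ x∈⁅y⁆ = here (x∈⁅y⁆⇒x≡y y x∈⁅y⁆)
... | inj₂ x∈ys  = there (∈-fromList⁻ ys x∈ys)

∈-allMaps : ∀ {k} (V : Vec (Fin k) k) → V ∈ allMaps k
∈-allMaps V = ∈-vecs V (λ _ → ∈-allFin _)

allMaps⁺ : ∀ k → Unique (allMaps k)
allMaps⁺ k = vecs⁺ (Unique.allFin⁺ k) k

asMap-range : ∀ {k} (M : Vec (Fin k) k) a → 1 ≤ asMap M a × asMap M a ≤ k
asMap-range M a = s≤s z≤n , toℕ<n (lookup M a)

fromℕ-or : ∀ {k} → ℕ → Fin k → Fin k
fromℕ-or {k} v default with v <? k
... | yes v<k = fromℕ< v<k
... | no  _   = default

toℕ-fromℕ-or : ∀ {k v} (default : Fin k) → v < k → toℕ (fromℕ-or v default) ≡ v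
toℕ-fromℕ-or {k} {v} _ v<k with v <? k
... | yes v<k′ = toℕ-fromℕ< v<k′
... | no  v≮k  = ⊥-elim (v≮k v<k)

encode : ∀ {k} → (Fin k → ℕ) → Vec (Fin k) k
encode f = tabulate (λ y → fromℕ-or (f y ∸ 1) y)

asMap-encode : ∀ {k} {f : Fin k → ℕ} → (∀ y → 1 ≤ f y × f y ≤ k) → ∀ y → asMap (encode f) y ≡ f y
asMap-encode {f = f} range y with f y | range y | lookup∘tabulate (λ y → fromℕ-or (f y ∸ 1) y) y
... | suc v | _ , v<k | lookup≡ = cong suc (trans (cong toℕ lookup≡) (toℕ-fromℕ-or y v<k))

encode-cong : ∀ {k} {f g : Fin k → ℕ} → (∀ y → f y ≡ g y) → encode f ≡ encode g
encode-cong f≗g = tabulate-cong (λ y → cong (λ v → fromℕ-or (v ∸ 1) y) (f≗g y))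

encode-asMap : ∀ {k} (V : Vec (Fin k) k) → encode (asMap V) ≡ V
encode-asMap V = trans (tabulate-cong (λ y → toℕ-injective (toℕ-fromℕ-or y (toℕ<n (lookup V y)))))
                       (tabulate∘lookup V)

suc-∸1 : ∀ {v} → 1 ≤ v → suc (v ∸ 1) ≡ v
suc-∸1 {suc _} _ = refl

IsLabeling-resp-≗ : ∀ {k} {f g : Fin k → ℕ} → (∀ y → f y ≡ g y) → IsLabeling k f → IsLabeling k g
IsLabeling-resp-≗ f≗g (range , injective , onto) =
  (λ y → subst (λ v → 1 ≤ v × v ≤ _) (f≗g y) (range y)) ,
  (λ a b ga≡gb → injective a b (trans (f≗g a) (trans ga≡gb (sym (f≗g b))))) ,
  (λ i → let y , fy≡ = onto i in y , trans (sym (f≗g y)) fy≡)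

IsLinearExtension-resp-≗ : ∀ {k} {R : Rel (Fin k) 0ℓ} {f g : Fin k → ℕ} → (∀ y → f y ≡ g y) →
                           IsLinearExtension k R f → IsLinearExtension k R g
IsLinearExtension-resp-≗ f≗g (labeling , monotone) =
  IsLabeling-resp-≗ f≗g labeling , λ a b aRb → subst₂ _≤_ (f≗g a) (f≗g b) (monotone a b aRb)

module Promotion {n : ℕ} (P : FinPoset n) where
  open FinPoset P
  open IsPartialOrder isPartialOrder using (antisym) renaming (refl to ≼-refl; trans to ≼-trans)

  ≺-trans : ∀ {a b c} → _≺_ P a b → _≺_ P b c → _≺_ P a c
  ≺-trans (a≼b , a≢b) (b≼c , _) = ≼-trans a≼b b≼c , λ { refl → a≢b (antisym a≼b b≼c) }

  strict-isChain : ∀ {xs} → AllPairs (_≺_ P) xs → IsChain P (fromList xs)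
  strict-isChain {xs} pairs a b a∈ b∈ with AllPairs-∈-total pairs (∈-fromList⁻ xs a∈) (∈-fromList⁻ xs b∈)
  ... | inj₁ refl             = inj₁ ≼-refl
  ... | inj₂ (inj₁ (a≼b , _)) = inj₁ a≼b
  ... | inj₂ (inj₂ (b≼a , _)) = inj₂ b≼a

  module LinearExtension {D : Fin n → ℕ} (D-linExt : IsLinearExtension n _≼_ D) where

    D-range : ∀ y → 1 ≤ D y × D y ≤ n
    D-range = proj₁ (proj₁ D-linExt)

    D-injective : ∀ a b → D a ≡ D b → a ≡ b
    D-injective = proj₁ (proj₂ (proj₁ D-linExt))

    D-onto : ∀ (i : Fin n) → ∃ λ y → D y ≡ suc (toℕ i)
    D-onto = proj₂ (proj₂ (proj₁ D-linExt))

    D-mono : ∀ a b → a ≼ b → D a ≤ D b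
    D-mono = proj₂ D-linExt

    D-strict : ∀ {a b} → _≺_ P a b → D a < D b
    D-strict {a} {b} (a≼b , a≢b) = ≤∧≢⇒< (D-mono a b a≼b) (a≢b ∘ D-injective a b)

    D-hits : ∀ {v} → 1 ≤ v → v ≤ n → ∃ λ y → D y ≡ v
    D-hits {suc v} _ v<n with D-onto (fromℕ< v<n)
    ... | y , Dy≡ = y , trans Dy≡ (cong suc (toℕ-fromℕ< v<n))

    below-in-prefix : ∀ pre {y rest c} → AllPairs (_≺_ P) (pre ++ y ∷ rest) →
                      c ∈ pre ++ y ∷ rest → D c < D y → c ∈ pre
    below-in-prefix pre pairs c∈ Dc<Dy with ∈-++⁻ pre c∈
    ... | inj₁ c∈pre          = c∈pre
    ... | inj₂ (here refl)    = ⊥-elim (<-irrefl refl Dc<Dy)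
    ... | inj₂ (there c∈rest) with AllPairs-++⁻ʳ pre pairs
    ...   | y≺rest ∷ _ = ⊥-elim (<-irrefl refl (<-trans Dc<Dy (D-strict (All.lookup y≺rest c∈rest))))

    module Top {x : Fin n} (D-top : D x ≡ n) where

      top-maximal : IsMaximal P x
      top-maximal y x≼y =
        D-injective x y (≤-antisym (D-mono x y x≼y) (subst (D y ≤_) (sym D-top) (proj₂ (D-range y))))

      below-top : ∀ {y} → x ≢ y → D y < n
      below-top {y} x≢y =
        ≤∧≢⇒< (proj₂ (D-range y)) (λ Dy≡n → x≢y (D-injective x y (trans D-top (sym Dy≡n))))

      top-unique : ∀ {y} → n ≤ D y → y ≡ x
      top-unique {y} n≤Dy = D-injective y x (trans (≤-antisym (proj₂ (D-range y)) n≤Dy) (sym D-top))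

  module _ (ℓ : Fin n → ℕ) where

    IsArgmin : List (Fin n) → Maybe (Fin n) → Set
    IsArgmin xs nothing  = xs ≡ []
    IsArgmin xs (just w) = w ∈ xs × (∀ {y} → y ∈ xs → ℓ w ≤ ℓ y)

    argmin-isArgmin : ∀ xs → IsArgmin xs (argmin P ℓ xs)
    argmin-isArgmin []       = refl
    argmin-isArgmin (y ∷ ys) with argmin P ℓ ys | argmin-isArgmin ys
    ... | nothing | refl = here refl , λ { (here refl) → ≤-refl }
    ... | just z  | z∈ys , z-least with ℓ z <? ℓ y
    ...   | yes ℓz<ℓy = there z∈ys , λ { (here refl) → <⇒≤ ℓz<ℓy ; (there y∈) → z-least y∈ }
    ...   | no  ℓz≮ℓy = here refl , λ { (here refl) → ≤-refl ; (there y∈) → ≤-trans (≮⇒≥ ℓz≮ℓy) (z-least y∈) }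

    argmin-just : ∀ {xs z} → z ∈ xs → ∃ λ w → argmin P ℓ xs ≡ just w × IsArgmin xs (just w)
    argmin-just {xs} z∈xs with argmin P ℓ xs | argmin-isArgmin xs
    ... | just w  | w-argmin = w , refl , w-argmin
    ... | nothing | refl with () ← z∈xs

    argmin-unique : ∀ {xs w} → w ∈ xs → (∀ {y} → y ∈ xs → y ≢ w → ℓ w < ℓ y) → argmin P ℓ xs ≡ just w
    argmin-unique {w = w} w∈xs w-strictly-least with argmin-just w∈xs
    ... | w′ , argmin≡w′ , w′∈xs , w′-least with w′ ≟ w
    ...   | yes refl = argmin≡w′
    ...   | no  w′≢w = ⊥-elim (<-irrefl refl (<-≤-trans (w-strictly-least w′∈xs w′≢w) (w′-least w∈xs)))

    minimum-exists : ∀ {Q : Fin n → Set} (Q? : Decidable Q) {z} → Q z →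
                     ∃ λ w → Q w × (∀ {y} → Q y → ℓ w ≤ ℓ y)
    minimum-exists Q? Qz with argmin-just (∈-filter⁺ Q? (∈-allFin _) Qz)
    ... | w , _ , w∈ , w-least =
      w , proj₂ (∈-filter⁻ Q? {xs = allFin n} w∈) , λ Qy → w-least (∈-filter⁺ Q? (∈-allFin _) Qy)

    inverse-just : ∀ {v i} → ℓ v ≡ i → ∃ λ w → inverse P ℓ i ≡ just w × ℓ w ≡ i
    inverse-just {i = i} ℓv≡i with argmin-just (∈-filter⁺ (λ y → ℓ y ℕ.≟ i) (∈-allFin _) ℓv≡i)
    ... | w , inverse≡w , w∈ , _ =
      w , inverse≡w , proj₂ (∈-filter⁻ (λ y → ℓ y ℕ.≟ i) {xs = allFin n} w∈)

    successor-≺ : ∀ {x y} → successor P ℓ x ≡ just y → _≺_ P x y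
    successor-≺ {x} succ≡y =
      proj₂ (∈-filter⁻ (_≺?_ P x) {xs = allFin n} (proj₁ (subst (IsArgmin _) succ≡y (argmin-isArgmin _))))

    successor-maximal : ∀ {x} → IsMaximal P x → successor P ℓ x ≡ nothing
    successor-maximal {x} x-max = cong (argmin P ℓ) (filter-none (_≺?_ P x)
      (All.universal (λ y (x≼y , x≢y) → x≢y (x-max y x≼y)) (allFin n)))

    successor-unique : ∀ {x w} → _≺_ P x w → (∀ {y} → _≺_ P x y → y ≢ w → ℓ w < ℓ y) →
                       successor P ℓ x ≡ just w
    successor-unique {x} x≺w w-least =
      argmin-unique (∈-filter⁺ (_≺?_ P x) (∈-allFin _) x≺w)
                    (λ y∈ → w-least (proj₂ (∈-filter⁻ (_≺?_ P x) {xs = allFin n} y∈)))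

    _↝_ : Fin n → Fin n → Set
    a ↝ b = successor P ℓ a ≡ just b

    chainFrom-head : ∀ k s → ∃ λ rest → chainFrom P ℓ k s ≡ s ∷ rest
    chainFrom-head zero    s = [] , refl
    chainFrom-head (suc k) s with successor P ℓ s
    ... | nothing = [] , refl
    ... | just w  = chainFrom P ℓ k w , refl

    chainFrom-linked : ∀ k s → Linked _↝_ (chainFrom P ℓ k s)
    chainFrom-linked zero    s = [-]
    chainFrom-linked (suc k) s with successor P ℓ s in s↝w
    ... | nothing = [-]
    ... | just w with chainFrom-head k w | chainFrom-linked k w
    ...   | rest , chain≡ | linked rewrite chain≡ = s↝w ∷ linked

    chainFrom-just : ∀ {k s w} → s ↝ w → chainFrom P ℓ (suc k) s ≡ s ∷ chainFrom P ℓ k w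
    chainFrom-just {s = s} s↝w with successor P ℓ s
    chainFrom-just refl | just _ = refl

    chainFrom-nothing : ∀ {k s} → successor P ℓ s ≡ nothing → chainFrom P ℓ (suc k) s ≡ [ s ]
    chainFrom-nothing {s = s} succ≡ with successor P ℓ s
    chainFrom-nothing refl | nothing = refl

    promotionChain-linked : Linked _↝_ (promotionChain P ℓ)
    promotionChain-linked with inverse P ℓ 1
    ... | nothing = []
    ... | just v  = chainFrom-linked n v

    promotionChain-strict : AllPairs (_≺_ P) (promotionChain P ℓ)
    promotionChain-strict = Linked⇒AllPairs ≺-trans (Linked.map successor-≺ promotionChain-linked)

    promotionChain-unique : Unique (promotionChain P ℓ)
    promotionChain-unique = AllPairs.map proj₂ promotionChain-strict

    promotionChain-adjacent : ∀ pre {a b post} → promotionChain P ℓ ≡ pre ++ a ∷ b ∷ post → a ↝ b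
    promotionChain-adjacent pre chain≡ =
      Linked-adjacent pre (subst (Linked _↝_) chain≡ promotionChain-linked)

    nextLabel : List (Fin n) → ℕ
    nextLabel []      = n
    nextLabel (b ∷ _) = ℓ b ∸ 1

    onChainFrom-∈ : ∀ pre {v vs y} rest → v ∷ vs ≡ pre ++ y ∷ rest → Unique (v ∷ vs) →
                    onChainFrom P ℓ v vs y ≡ just (nextLabel rest)
    onChainFrom-∈ [] {v} {[]} _ refl _ with v ≟ v
    ... | yes _   = refl
    ... | no  v≢v = ⊥-elim (v≢v refl)
    onChainFrom-∈ [] {v} {_ ∷ _} _ refl _ with v ≟ v
    ... | yes _   = refl
    ... | no  v≢v = ⊥-elim (v≢v refl)
    onChainFrom-∈ (_ ∷ [])    {vs = []} _ () _
    onChainFrom-∈ (_ ∷ _ ∷ _) {vs = []} _ () _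
    onChainFrom-∈ (p ∷ pre) {v} {w ∷ vs} {y} rest chain≡ (v∉ ∷ unique) with y ≟ v | ∷-injective chain≡
    ... | yes refl | _ , tail≡ =
      ⊥-elim (All.lookup v∉ (subst (y ∈_) (sym tail≡) (∈-++⁺ʳ pre (here refl))) refl)
    ... | no  _    | _ , tail≡ = onChainFrom-∈ pre rest tail≡ unique

    onChainFrom-∉ : ∀ {y} v vs → y ∉ v ∷ vs → onChainFrom P ℓ v vs y ≡ nothing
    onChainFrom-∉ {y} v [] y∉ with y ≟ v
    ... | yes refl = ⊥-elim (y∉ (here refl))
    ... | no  _    = refl
    onChainFrom-∉ {y} v (w ∷ vs) y∉ with y ≟ v
    ... | yes refl = ⊥-elim (y∉ (here refl))
    ... | no  _    = onChainFrom-∉ w vs (y∉ ∘ there)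

    ∂-∈ : ∀ pre {y} rest → promotionChain P ℓ ≡ pre ++ y ∷ rest → ∂ P ℓ y ≡ nextLabel rest
    ∂-∈ pre {y} rest chain≡ with promotionChain P ℓ | promotionChain-unique
    ... | []     | _      = ⊥-elim ([]≢++∷ pre chain≡)
    ... | v ∷ vs | unique = cong (maybe′ id (ℓ y ∸ 1)) (onChainFrom-∈ pre rest chain≡ unique)

    ∂-∉ : ∀ {y} → y ∉ promotionChain P ℓ → ∂ P ℓ y ≡ ℓ y ∸ 1
    ∂-∉ {y} y∉ with promotionChain P ℓ
    ... | []     = refl
    ... | v ∷ vs = cong (maybe′ id (ℓ y ∸ 1)) (onChainFrom-∉ v vs y∉)

  -- Recovering a labeling from its promotion D and the set C of its promotion chain

  module _ (D : Fin n → ℕ) (C : Subset n) where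

    below : Fin n → List (Fin n)
    below y = filter (λ c → (c ∈ₛ? C) ×-dec (D c <? D y)) (allFin n)

    ∈-below⁺ : ∀ {c y} → c ∈ₛ C → D c < D y → c ∈ below y
    ∈-below⁺ {y = y} c∈C Dc<Dy =
      ∈-filter⁺ (λ c → (c ∈ₛ? C) ×-dec (D c <? D y)) (∈-allFin _) (c∈C , Dc<Dy)

    ∈-below⁻ : ∀ {c y} → c ∈ below y → c ∈ₛ C × D c < D y
    ∈-below⁻ {y = y} c∈ = proj₂ (∈-filter⁻ (λ c → (c ∈ₛ? C) ×-dec (D c <? D y)) {xs = allFin n} c∈)

    predValue : Fin n → ℕ
    predValue y = max 0 (map D (below y))

    unpromote : Fin n → ℕ
    unpromote y with y ∈ₛ? C
    ... | yes _ = suc (predValue y)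
    ... | no  _ = suc (D y)

    unpromote-∈ : ∀ {y} → y ∈ₛ C → unpromote y ≡ suc (predValue y)
    unpromote-∈ {y} y∈C with y ∈ₛ? C
    ... | yes _   = refl
    ... | no  y∉C = ⊥-elim (y∉C y∈C)

    unpromote-∉ : ∀ {y} → y ∉ₛ C → unpromote y ≡ suc (D y)
    unpromote-∉ {y} y∉C with y ∈ₛ? C
    ... | yes y∈C = ⊥-elim (y∉C y∈C)
    ... | no  _   = refl

    unpromote-view : ∀ y → (y ∈ₛ C × unpromote y ≡ suc (predValue y)) ⊎ (y ∉ₛ C × unpromote y ≡ suc (D y))
    unpromote-view y with y ∈ₛ? C
    ... | yes y∈C = inj₁ (y∈C , refl)
    ... | no  y∉C = inj₂ (y∉C , refl)

    predValue-≥ : ∀ {c y} → c ∈ₛ C → D c < D y → D c ≤ predValue y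
    predValue-≥ c∈C Dc<Dy = All.lookup (xs≤max 0 (map D (below _))) (∈-map⁺ D (∈-below⁺ c∈C Dc<Dy))

    predValue-< : ∀ {y} → 1 ≤ D y → predValue y < D y
    predValue-< 1≤Dy = max<v⁺ 1≤Dy (All.map⁺ (All.tabulate (proj₂ ∘ ∈-below⁻)))

    predValue-sel : ∀ y → predValue y ≡ 0 ⊎ ∃ λ c → (c ∈ₛ C × D c < D y) × predValue y ≡ D c
    predValue-sel y with argmax-sel id 0 (map D (below y))
    ... | inj₁ max≡0 = inj₁ max≡0
    ... | inj₂ max∈  with ∈-map⁻ D max∈
    ...   | c , c∈ , max≡Dc = inj₂ (c , ∈-below⁻ c∈ , max≡Dc)

    predValue-≡ : ∀ {a y} → a ∈ₛ C → D a < D y → (∀ {c} → c ∈ₛ C → D c < D y → D c ≤ D a) →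
                  predValue y ≡ D a
    predValue-≡ a∈C Da<Dy a-greatest =
      max≈v⁺ (∈-map⁺ D (∈-below⁺ a∈C Da<Dy))
             (All.map⁺ (All.tabulate (λ c∈ → uncurry a-greatest (∈-below⁻ c∈))))
             z≤n

    predValue-0 : ∀ {y} → (∀ {c} → c ∈ₛ C → D c < D y → ⊥) → predValue y ≡ 0
    predValue-0 {y} y-least with predValue-sel y
    ... | inj₁ ≡0                       = ≡0
    ... | inj₂ (c , (c∈C , Dc<Dy) , _) = ⊥-elim (y-least c∈C Dc<Dy)

  unpromote-cong : ∀ {D D′ : Fin n → ℕ} C → (∀ y → D y ≡ D′ y) → ∀ y → unpromote D C y ≡ unpromote D′ C y
  unpromote-cong {D} {D′} C D≗D′ y with y ∈ₛ? C
  ... | yes _ = cong (suc ∘ max 0) (trans (map-cong D≗D′ _)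
    (cong (map D′) (filter-≐ _ _ (transport D≗D′ , transport (sym ∘ D≗D′)) (allFin n))))
    where
    transport : ∀ {E E′ : Fin n → ℕ} → (∀ z → E z ≡ E′ z) →
                ∀ {c} → c ∈ₛ C × E c < E y → c ∈ₛ C × E′ c < E′ y
    transport E≗E′ (c∈C , Ec<Ey) = c∈C , subst₂ _<_ (E≗E′ _) (E≗E′ y) Ec<Ey
  ... | no  _ = cong suc (D≗D′ y)

  module Unpromote {x : Fin n} {C : Subset n} {D : Fin n → ℕ}
                   (D-linExt : IsLinearExtension n _≼_ D) (D-top : D x ≡ n)
                   (C-chain : IsChainContaining P x C) where
    open LinearExtension D-linExt
    open Top D-top

    x∈C : x ∈ₛ C
    x∈C = proj₁ C-chain

    x≢∉C : ∀ {y} → y ∉ₛ C → x ≢ y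
    x≢∉C y∉C refl = y∉C x∈C

    predValue-<D : ∀ y → predValue D C y < D y
    predValue-<D y = predValue-< D C (proj₁ (D-range y))

    predValue-injective : ∀ {a b} → a ∈ₛ C → b ∈ₛ C → predValue D C a ≡ predValue D C b → a ≡ b
    predValue-injective {a} {b} a∈C b∈C pa≡pb with <-cmp (D a) (D b)
    ... | tri< Da<Db _ _ =
      ⊥-elim (<-irrefl pa≡pb (<-≤-trans (predValue-<D a) (predValue-≥ D C a∈C Da<Db)))
    ... | tri≈ _ Da≡Db _ = D-injective a b Da≡Db
    ... | tri> _ _ Db<Da =
      ⊥-elim (<-irrefl (sym pa≡pb) (<-≤-trans (predValue-<D b) (predValue-≥ D C b∈C Db<Da)))

    predValue≢D∉C : ∀ {a b} → b ∉ₛ C → predValue D C a ≢ D b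
    predValue≢D∉C {a} {b} b∉C pa≡Db with predValue-sel D C a
    ... | inj₁ pa≡0 with () ← subst (1 ≤_) (trans (sym pa≡Db) pa≡0) (proj₁ (D-range b))
    ... | inj₂ (c , (c∈C , _) , pa≡Dc) =
      b∉C (subst (_∈ₛ C) (D-injective c b (trans (sym pa≡Dc) pa≡Db)) c∈C)

    unpromote-range : ∀ y → 1 ≤ unpromote D C y × unpromote D C y ≤ n
    unpromote-range y with unpromote-view D C y
    ... | inj₁ (_ , ℓy≡) =
      subst (1 ≤_) (sym ℓy≡) (s≤s z≤n) , subst (_≤ n) (sym ℓy≡) (≤-trans (predValue-<D y) (proj₂ (D-range y)))
    ... | inj₂ (y∉C , ℓy≡) =
      subst (1 ≤_) (sym ℓy≡) (s≤s z≤n) , subst (_≤ n) (sym ℓy≡) (below-top (x≢∉C y∉C))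

    unpromote-injective : ∀ a b → unpromote D C a ≡ unpromote D C b → a ≡ b
    unpromote-injective a b ℓa≡ℓb with unpromote-view D C a | unpromote-view D C b
    ... | inj₁ (a∈C , ℓa≡) | inj₁ (b∈C , ℓb≡) =
      predValue-injective a∈C b∈C (suc-injective (trans (sym ℓa≡) (trans ℓa≡ℓb ℓb≡)))
    ... | inj₁ (_ , ℓa≡)   | inj₂ (b∉C , ℓb≡) =
      ⊥-elim (predValue≢D∉C b∉C (suc-injective (trans (sym ℓa≡) (trans ℓa≡ℓb ℓb≡))))
    ... | inj₂ (a∉C , ℓa≡) | inj₁ (_ , ℓb≡)   =
      ⊥-elim (predValue≢D∉C a∉C (suc-injective (trans (sym ℓb≡) (trans (sym ℓa≡ℓb) ℓa≡))))
    ... | inj₂ (_ , ℓa≡)   | inj₂ (_ , ℓb≡)   =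
      D-injective a b (suc-injective (trans (sym ℓa≡) (trans ℓa≡ℓb ℓb≡)))

    first : ∃ λ v → v ∈ₛ C × (∀ {c} → c ∈ₛ C → D v ≤ D c)
    first = minimum-exists D (_∈ₛ? C) x∈C

    IsNextIn : Fin n → Fin n → Set
    IsNextIn c w = (w ∈ₛ C × D c < D w) × (∀ {c′} → c′ ∈ₛ C × D c < D c′ → D w ≤ D c′)

    next : ∀ {c} → x ≢ c → ∃ (IsNextIn c)
    next {c} x≢c = minimum-exists D (λ w → (w ∈ₛ? C) ×-dec (D c <? D w))
                                    (x∈C , subst (D c <_) (sym D-top) (below-top x≢c))

    unpromote-least : ∀ {v} → v ∈ₛ C → (∀ {c} → c ∈ₛ C → D v ≤ D c) → unpromote D C v ≡ 1
    unpromote-least v∈C v-least = trans (unpromote-∈ D C v∈C)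
      (cong suc (predValue-0 D C (λ c∈C Dc<Dv → <-irrefl refl (<-≤-trans Dc<Dv (v-least c∈C)))))

    unpromote-next : ∀ {c w} → c ∈ₛ C → IsNextIn c w → unpromote D C w ≡ suc (D c)
    unpromote-next c∈C ((w∈C , Dc<Dw) , w-least) = trans (unpromote-∈ D C w∈C) (cong suc
      (predValue-≡ D C c∈C Dc<Dw (λ c′∈C Dc′<Dw →
        ≮⇒≥ (λ Dc<Dc′ → <-irrefl refl (<-≤-trans Dc′<Dw (w-least (c′∈C , Dc<Dc′)))))))

    unpromote-onto : ∀ (i : Fin n) → ∃ λ y → unpromote D C y ≡ suc (toℕ i)
    unpromote-onto i with toℕ i | toℕ<n i
    ... | zero  | _   = let v , v∈C , v-least = first in v , unpromote-least v∈C v-least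
    ... | suc j | i<n with D-hits (s≤s z≤n) (<⇒≤ i<n)
    ...   | z , Dz≡ with z ∈ₛ? C
    ...     | no  z∉C = z , trans (unpromote-∉ D C z∉C) (cong suc Dz≡)
    ...     | yes z∈C with next {z} (λ x≡z → <-irrefl (trans (sym Dz≡) (trans (cong D (sym x≡z)) D-top)) i<n)
    ...       | w , w-next = w , trans (unpromote-next z∈C w-next) (cong suc Dz≡)

    unpromote-isLabeling : IsLabeling n (unpromote D C)
    unpromote-isLabeling = unpromote-range , unpromote-injective , unpromote-onto

    module _ {ℓ : Fin n → ℕ} (ℓ≗ : ∀ y → ℓ y ≡ unpromote D C y) where

      next-strictly-least : ∀ {c w y} → IsNextIn c w → _≺_ P c y → y ≢ w → suc (D c) < unpromote D C y
      next-strictly-least {c} {w} {y} ((w∈C , Dc<Dw) , w-least) c≺y y≢w with unpromote-view D C y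
      ... | inj₁ (y∈C , ℓy≡) =
        subst (suc (D c) <_) (sym ℓy≡) (s≤s (<-≤-trans Dc<Dw (predValue-≥ D C w∈C Dw<Dy)))
        where
        Dw<Dy : D w < D y
        Dw<Dy = ≤∧≢⇒< (w-least (y∈C , D-strict c≺y)) (λ Dw≡Dy → y≢w (D-injective y w (sym Dw≡Dy)))
      ... | inj₂ (_ , ℓy≡) = subst (suc (D c) <_) (sym ℓy≡) (s≤s (D-strict c≺y))

      successor-next : ∀ {c w} → c ∈ₛ C → IsNextIn c w → successor P ℓ c ≡ just w
      successor-next {c} {w} c∈C w-next@((w∈C , Dc<Dw) , _) = successor-unique ℓ c≺w
        (λ c≺y y≢w → subst₂ _<_ (sym ℓw≡) (sym (ℓ≗ _)) (next-strictly-least w-next c≺y y≢w))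
        where
        ℓw≡ : ℓ w ≡ suc (D c)
        ℓw≡ = trans (ℓ≗ w) (unpromote-next c∈C w-next)
        c≺w : _≺_ P c w
        c≺w with proj₂ C-chain c w c∈C w∈C
        ... | inj₁ c≼w = c≼w , λ { refl → <-irrefl refl Dc<Dw }
        ... | inj₂ w≼c = ⊥-elim (<-irrefl refl (<-≤-trans Dc<Dw (D-mono w c w≼c)))

      successor-top : successor P ℓ x ≡ nothing
      successor-top = successor-maximal ℓ top-maximal

      ℓ-successor : ∀ {y b} → y ∈ₛ C → successor P ℓ y ≡ just b → ℓ b ≡ suc (D y)
      ℓ-successor {y} y∈C y↝b with x ≟ y
      ... | yes refl with () ← trans (sym successor-top) y↝b
      ... | no  x≢y with next x≢y
      ...   | w , w-next with refl ← trans (sym y↝b) (successor-next y∈C w-next) =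
        trans (ℓ≗ w) (unpromote-next y∈C w-next)

      -- The fuel bound n ≤ k + D s holds all along the chain because D increases along it.
      record ChainFromSpec (k : ℕ) (s : Fin n) : Set where
        field
          ends-at-top : ∃ λ pre → chainFrom P ℓ k s ≡ pre ∷ʳ x
          covers      : ∀ {c} → c ∈ₛ C → D s ≤ D c → c ∈ chainFrom P ℓ k s
          within      : ∀ {c} → c ∈ chainFrom P ℓ k s → c ∈ₛ C
      open ChainFromSpec

      chainFrom-top-≡ : ∀ k → chainFrom P ℓ k x ≡ [ x ]
      chainFrom-top-≡ zero    = refl
      chainFrom-top-≡ (suc k) = chainFrom-nothing ℓ successor-top

      chainFrom-top : ∀ k → ChainFromSpec k x
      chainFrom-top k .ends-at-top = [] , chainFrom-top-≡ k
      chainFrom-top k .covers c∈C Dx≤Dc =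
        subst (_ ∈_) (sym (chainFrom-top-≡ k)) (here (top-unique (subst (_≤ D _) D-top Dx≤Dc)))
      chainFrom-top k .within c∈ with subst (_ ∈_) (chainFrom-top-≡ k) c∈
      ... | here refl = x∈C

      chainFrom-spec : ∀ k {s} → s ∈ₛ C → n ≤ k + D s → ChainFromSpec k s
      chainFrom-spec zero    s∈C n≤Ds rewrite top-unique n≤Ds = chainFrom-top zero
      chainFrom-spec (suc k) {s} s∈C n≤k+Ds with x ≟ s
      ... | yes refl = chainFrom-top (suc k)
      ... | no  x≢s with next x≢s
      ...   | w , w-next@((w∈C , Ds<Dw) , w-least) = spec
        where
        chain≡ : chainFrom P ℓ (suc k) s ≡ s ∷ chainFrom P ℓ k w
        chain≡ = chainFrom-just ℓ (successor-next s∈C w-next)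
        tail-spec : ChainFromSpec k w
        tail-spec = chainFrom-spec k w∈C
          (≤-trans n≤k+Ds (subst (_≤ k + D w) (+-suc k (D s)) (+-monoʳ-≤ k Ds<Dw)))
        spec : ChainFromSpec (suc k) s
        spec .ends-at-top =
          let pre , tail≡ = tail-spec .ends-at-top in s ∷ pre , trans chain≡ (cong (s ∷_) tail≡)
        spec .covers {c} c∈C Ds≤Dc = subst (c ∈_) (sym chain≡) (covers′ (c ≟ s))
          where
          covers′ : Dec (c ≡ s) → c ∈ s ∷ chainFrom P ℓ k w
          covers′ (yes c≡s) = here c≡s
          covers′ (no  c≢s) = there (tail-spec .covers c∈C
            (w-least (c∈C , ≤∧≢⇒< Ds≤Dc (λ Ds≡Dc → c≢s (D-injective c s (sym Ds≡Dc))))))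
        spec .within c∈ with subst (_ ∈_) chain≡ c∈
        ... | here refl = s∈C
        ... | there c∈′ = tail-spec .within c∈′

      v₁ : Fin n
      v₁ = proj₁ first

      v₁∈C : v₁ ∈ₛ C
      v₁∈C = proj₁ (proj₂ first)

      ℓv₁≡1 : ℓ v₁ ≡ 1
      ℓv₁≡1 = trans (ℓ≗ v₁) (unpromote-least v₁∈C (proj₂ (proj₂ first)))

      inverse-first : inverse P ℓ 1 ≡ just v₁
      inverse-first with inverse-just ℓ ℓv₁≡1
      ... | w , inverse≡w , ℓw≡1 = trans inverse≡w (cong just
        (unpromote-injective w v₁ (trans (sym (ℓ≗ w)) (trans ℓw≡1 (trans (sym ℓv₁≡1) (ℓ≗ v₁))))))

      promotionChain≡ : promotionChain P ℓ ≡ chainFrom P ℓ n v₁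
      promotionChain≡ = cong (maybe′ (chainFrom P ℓ n) []) inverse-first

      chain-spec : ChainFromSpec n v₁
      chain-spec = chainFrom-spec n v₁∈C (m≤m+n n (D v₁))

      promotionChain-ends : ∃ λ pre → promotionChain P ℓ ≡ pre ∷ʳ x
      promotionChain-ends = let pre , chain≡ = chain-spec .ends-at-top in pre , trans promotionChain≡ chain≡

      ∈-promotionChain⁺ : ∀ {c} → c ∈ₛ C → c ∈ promotionChain P ℓ
      ∈-promotionChain⁺ c∈C =
        subst (_ ∈_) (sym promotionChain≡) (chain-spec .covers c∈C (proj₂ (proj₂ first) c∈C))

      ∈-promotionChain⁻ : ∀ {c} → c ∈ promotionChain P ℓ → c ∈ₛ C
      ∈-promotionChain⁻ c∈ = chain-spec .within (subst (_ ∈_) promotionChain≡ c∈)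

      promotionChain-set : fromList (promotionChain P ℓ) ≡ C
      promotionChain-set = ⊆-antisym (∈-promotionChain⁻ ∘ ∈-fromList⁻ _) (∈-fromList⁺ ∘ ∈-promotionChain⁺)

      ∂-on-chain : ∀ pre {y} rest → y ∈ₛ C → promotionChain P ℓ ≡ pre ++ y ∷ rest → ∂ P ℓ y ≡ D y
      ∂-on-chain pre []         _   chain≡ with promotionChain-ends
      ... | pre′ , chain≡′ with refl ← ∷ʳ-injectiveʳ pre pre′ (trans (sym chain≡) chain≡′) =
        trans (∂-∈ ℓ pre [] chain≡) (sym D-top)
      ∂-on-chain pre (b ∷ rest) y∈C chain≡ =
        trans (∂-∈ ℓ pre (b ∷ rest) chain≡)
              (cong (_∸ 1) (ℓ-successor y∈C (promotionChain-adjacent ℓ pre chain≡)))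

      ∂≗D : ∀ y → ∂ P ℓ y ≡ D y
      ∂≗D y with unpromote-view D C y
      ... | inj₁ (y∈C , _) =
        let pre , rest , chain≡ = ∈-∃++ (∈-promotionChain⁺ y∈C) in ∂-on-chain pre rest y∈C chain≡
      ... | inj₂ (y∉C , ℓy≡) =
        trans (∂-∉ ℓ (y∉C ∘ ∈-promotionChain⁻)) (cong (_∸ 1) (trans (ℓ≗ y) ℓy≡))

      unpromote-sortable : IsSortableLabeling P ℓ
      unpromote-sortable =
        IsLabeling-resp-≗ (sym ∘ ℓ≗) unpromote-isLabeling , IsLinearExtension-resp-≗ (sym ∘ ∂≗D) D-linExt

module Bijection {m : ℕ} (P : FinPoset (suc m)) where
  open FinPoset P
  open Promotion P

  punchIn-view : ∀ (x y : Fin (suc m)) → x ≡ y ⊎ ∃ λ a → punchIn x a ≡ y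
  punchIn-view x y with x ≟ y
  ... | yes x≡y = inj₁ x≡y
  ... | no  x≢y = inj₂ (punchOut x≢y , punchIn-punchOut x≢y)

  extend : Fin (suc m) → Vec (Fin m) m → Fin (suc m) → ℕ
  extend x M y with x ≟ y
  ... | yes _   = suc m
  ... | no  x≢y = asMap M (punchOut x≢y)

  extend-top : ∀ x M → extend x M x ≡ suc m
  extend-top x M with x ≟ x
  ... | yes _   = refl
  ... | no  x≢x = ⊥-elim (x≢x refl)

  extend-punchIn : ∀ x M a → extend x M (punchIn x a) ≡ asMap M a
  extend-punchIn x M a with x ≟ punchIn x a
  ... | yes x≡ = ⊥-elim (punchInᵢ≢i x a (sym x≡))
  ... | no  x≢ = cong (asMap M) (trans (punchOut-cong x refl) (punchOut-punchIn x))

  module _ {x : Fin (suc m)} {M : Vec (Fin m) m} where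

    extend-range : ∀ y → 1 ≤ extend x M y × extend x M y ≤ suc m
    extend-range y with punchIn-view x y
    ... | inj₁ refl       =
      subst (λ v → 1 ≤ v × v ≤ suc m) (sym (extend-top x M)) (s≤s z≤n , ≤-refl)
    ... | inj₂ (a , refl) = subst (λ v → 1 ≤ v × v ≤ suc m) (sym (extend-punchIn x M a))
                                  (s≤s z≤n , ≤-trans (proj₂ (asMap-range M a)) (ℕ.n≤1+n m))

    top≢extend-punchIn : ∀ a → extend x M x ≢ extend x M (punchIn x a)
    top≢extend-punchIn a top≡ =
      <-irrefl (sym (trans (sym (extend-top x M)) (trans top≡ (extend-punchIn x M a))))
               (s≤s (proj₂ (asMap-range M a)))

    extend-injective : (∀ a b → asMap M a ≡ asMap M b → a ≡ b) →
                       ∀ y z → extend x M y ≡ extend x M z → y ≡ z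
    extend-injective M-injective y z eq with punchIn-view x y | punchIn-view x z
    ... | inj₁ refl       | inj₁ refl       = refl
    ... | inj₁ refl       | inj₂ (b , refl) = ⊥-elim (top≢extend-punchIn b eq)
    ... | inj₂ (a , refl) | inj₁ refl       = ⊥-elim (top≢extend-punchIn a (sym eq))
    ... | inj₂ (a , refl) | inj₂ (b , refl) =
      cong (punchIn x) (M-injective a b (trans (sym (extend-punchIn x M a)) (trans eq (extend-punchIn x M b))))

    extend-onto : (∀ (i : Fin m) → ∃ λ a → asMap M a ≡ suc (toℕ i)) →
                  ∀ (i : Fin (suc m)) → ∃ λ y → extend x M y ≡ suc (toℕ i)
    extend-onto M-onto i with m ℕ.≟ toℕ i
    ... | yes m≡i = x , trans (extend-top x M) (cong suc m≡i)
    ... | no  m≢i with M-onto (lower₁ i m≢i)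
    ...   | a , Ma≡ = punchIn x a , trans (extend-punchIn x M a) (trans Ma≡ (cong suc (toℕ-lower₁ i m≢i)))

    extend-mono : IsMaximal P x → (∀ a b → (P ∖≼ x) a b → asMap M a ≤ asMap M b) →
                  ∀ y z → y ≼ z → extend x M y ≤ extend x M z
    extend-mono x-max M-mono y z y≼z with punchIn-view x y | punchIn-view x z
    ... | _               | inj₁ refl       =
      subst (extend x M y ≤_) (sym (extend-top x M)) (proj₂ (extend-range y))
    ... | inj₁ refl       | inj₂ (b , refl) = ⊥-elim (punchInᵢ≢i x b (sym (x-max _ y≼z)))
    ... | inj₂ (a , refl) | inj₂ (b , refl) =
      subst₂ _≤_ (sym (extend-punchIn x M a)) (sym (extend-punchIn x M b)) (M-mono a b y≼z)

    extend-isLinearExtension : IsMaximal P x → IsLinearExtension m (P ∖≼ x) (asMap M) →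
                               IsLinearExtension (suc m) _≼_ (extend x M)
    extend-isLinearExtension x-max ((_ , M-injective , M-onto) , M-mono) =
      (extend-range , extend-injective M-injective , extend-onto M-onto) , extend-mono x-max M-mono

  restrict : (Fin (suc m) → ℕ) → Fin (suc m) → Vec (Fin m) m
  restrict D x = encode (D ∘ punchIn x)

  restrict-extend : ∀ x M → restrict (extend x M) x ≡ M
  restrict-extend x M = trans (encode-cong (extend-punchIn x M)) (encode-asMap M)

  module _ {D : Fin (suc m) → ℕ} (D-linExt : IsLinearExtension (suc m) _≼_ D)
           {x} (D-top : D x ≡ suc m) where
    open LinearExtension D-linExt
    open Top D-top

    asMap-restrict : ∀ a → asMap (restrict D x) a ≡ D (punchIn x a)
    asMap-restrict = asMap-encode (λ a → proj₁ (D-range _) , ≤-pred (below-top (punchInᵢ≢i x a ∘ sym)))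

    restrict-onto : ∀ (i : Fin m) → ∃ λ a → asMap (restrict D x) a ≡ suc (toℕ i)
    restrict-onto i with D-hits (s≤s z≤n) (s≤s (<⇒≤ (toℕ<n i)))
    ... | y , Dy≡ with punchIn-view x y
    ...   | inj₁ refl       = ⊥-elim (<-irrefl (trans (sym Dy≡) D-top) (s≤s (toℕ<n i)))
    ...   | inj₂ (a , refl) = a , trans (asMap-restrict a) Dy≡

    restrict-isLinearExtension : IsLinearExtension m (P ∖≼ x) (asMap (restrict D x))
    restrict-isLinearExtension =
      (asMap-range (restrict D x) , restrict-injective , restrict-onto) ,
      λ a b a≼b → subst₂ _≤_ (sym (asMap-restrict a)) (sym (asMap-restrict b)) (D-mono _ _ a≼b)
      where
      restrict-injective : ∀ a b → asMap (restrict D x) a ≡ asMap (restrict D x) b → a ≡ b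
      restrict-injective a b eq = punchIn-injective x a b
        (D-injective _ _ (trans (sym (asMap-restrict a)) (trans eq (asMap-restrict b))))

    extend-restrict : ∀ y → extend x (restrict D x) y ≡ D y
    extend-restrict y with punchIn-view x y
    ... | inj₁ refl       = trans (extend-top x _) (sym D-top)
    ... | inj₂ (a , refl) = trans (extend-punchIn x _ a) (asMap-restrict a)

  module Sortable {ℓ : Fin (suc m) → ℕ} (ℓ-sortable : IsSortableLabeling P ℓ) where
    open LinearExtension (proj₂ ℓ-sortable)

    chain : List (Fin (suc m))
    chain = promotionChain P ℓ

    C : Subset (suc m)
    C = fromList chain

    top : Fin (suc m)
    top = fromMaybe zero (last chain)

    ℓ≥1 : ∀ y → 1 ≤ ℓ y
    ℓ≥1 y = proj₁ (proj₁ (proj₁ ℓ-sortable) y)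

    first-label : ∃ λ v₁ → inverse P ℓ 1 ≡ just v₁ × ℓ v₁ ≡ 1
    first-label = inverse-just ℓ (proj₂ (proj₂ (proj₂ (proj₁ ℓ-sortable)) zero))

    chain-head : ∃ λ rest → chain ≡ proj₁ first-label ∷ rest
    chain-head =
      let v₁ , inverse≡v₁ , _ = first-label
          rest , chain≡ = chainFrom-head ℓ (suc m) v₁
      in rest , trans (cong (maybe′ (chainFrom P ℓ (suc m)) []) inverse≡v₁) chain≡

    chain-ends : ∃ λ pre → chain ≡ pre ∷ʳ top
    chain-ends with chain-head
    ... | rest , chain≡ with ∷-∷ʳ (proj₁ first-label) rest
    ...   | pre , x , ∷≡∷ʳ = pre , trans chain≡′ (cong (pre ∷ʳ_) (sym top≡x))
      where
      chain≡′ : chain ≡ pre ∷ʳ x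
      chain≡′ = trans chain≡ ∷≡∷ʳ
      top≡x : top ≡ x
      top≡x = cong (fromMaybe zero) (trans (cong last chain≡′) (last-∷ʳ pre x))

    top-∂ : ∂ P ℓ top ≡ suc m
    top-∂ = let pre , chain≡ = chain-ends in ∂-∈ ℓ pre [] chain≡

    open Top top-∂ public using (top-maximal)

    C-isChain : IsChainContaining P top C
    C-isChain = let pre , chain≡ = chain-ends
                in ∈-fromList⁺ (subst (top ∈_) (sym chain≡) (∈-++⁺ʳ pre (here refl))) ,
                   strict-isChain (promotionChain-strict ℓ)

    ℓ-first : ∀ {y} rest → chain ≡ y ∷ rest → ℓ y ≡ suc (predValue (∂ P ℓ) C y)
    ℓ-first rest chain≡ with chain-head
    ... | _ , chain≡′ with refl ← proj₁ (∷-injective (trans (sym chain≡) chain≡′)) =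
      trans (proj₂ (proj₂ first-label)) (cong suc (sym (predValue-0 (∂ P ℓ) C nothing-below)))
      where
      nothing-below : ∀ {c} → c ∈ₛ C → ∂ P ℓ c < ∂ P ℓ _ → ⊥
      nothing-below c∈C ∂c<∂y
        with () ← below-in-prefix [] (subst (AllPairs (_≺_ P)) chain≡ (promotionChain-strict ℓ))
                                     (subst (_ ∈_) chain≡ (∈-fromList⁻ chain c∈C)) ∂c<∂y

    ℓ-after : ∀ ini {a y} rest → chain ≡ (ini ∷ʳ a) ++ y ∷ rest → ℓ y ≡ suc (predValue (∂ P ℓ) C y)
    ℓ-after ini {a} {y} rest chain≡ =
      trans (sym (suc-∸1 (ℓ≥1 y))) (cong suc (sym (trans (predValue-≡ (∂ P ℓ) C a∈C ∂a<∂y a-greatest) ∂a≡)))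
      where
      pairs : AllPairs (_≺_ P) ((ini ∷ʳ a) ++ y ∷ rest)
      pairs = subst (AllPairs (_≺_ P)) chain≡ (promotionChain-strict ℓ)
      a∈ : a ∈ ini ∷ʳ a
      a∈ = ∈-++⁺ʳ ini (here refl)
      a∈C : a ∈ₛ C
      a∈C = ∈-fromList⁺ (subst (a ∈_) (sym chain≡) (∈-++⁺ˡ a∈))
      ∂a<∂y : ∂ P ℓ a < ∂ P ℓ y
      ∂a<∂y = D-strict (AllPairs-++-∈ (ini ∷ʳ a) pairs a∈ (here refl))
      ∂a≡ : ∂ P ℓ a ≡ ℓ y ∸ 1
      ∂a≡ = ∂-∈ ℓ ini (y ∷ rest) (trans chain≡ (++-assoc ini [ a ] (y ∷ rest)))
      a-greatest : ∀ {c} → c ∈ₛ C → ∂ P ℓ c < ∂ P ℓ y → ∂ P ℓ c ≤ ∂ P ℓ a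
      a-greatest c∈C ∂c<∂y
        with ∈-++⁻ ini (below-in-prefix (ini ∷ʳ a) pairs (subst (_ ∈_) chain≡ (∈-fromList⁻ chain c∈C)) ∂c<∂y)
      ... | inj₁ c∈ini       = <⇒≤ (D-strict (AllPairs-++-∈ ini
              (subst (AllPairs (_≺_ P)) (++-assoc ini [ a ] (y ∷ rest)) pairs) c∈ini (here refl)))
      ... | inj₂ (here refl) = ≤-refl

    ℓ-on-chain : ∀ pre {y} rest → chain ≡ pre ++ y ∷ rest → ℓ y ≡ suc (predValue (∂ P ℓ) C y)
    ℓ-on-chain []       rest chain≡ = ℓ-first rest chain≡
    ℓ-on-chain (p ∷ ps) rest chain≡ =
      let ini , a , ps≡ = ∷-∷ʳ p ps in ℓ-after ini rest (trans chain≡ (cong (_++ _ ∷ rest) ps≡))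

    ℓ≗unpromote : ∀ y → ℓ y ≡ unpromote (∂ P ℓ) C y
    ℓ≗unpromote y with unpromote-view (∂ P ℓ) C y
    ... | inj₁ (y∈C , ℓ₀y≡) =
      let pre , rest , chain≡ = ∈-∃++ (∈-fromList⁻ chain y∈C) in trans (ℓ-on-chain pre rest chain≡) (sym ℓ₀y≡)
    ... | inj₂ (y∉C , ℓ₀y≡) =
      trans (sym (suc-∸1 (ℓ≥1 y))) (trans (cong suc (sym (∂-∉ ℓ (y∉C ∘ ∈-fromList⁺)))) (sym ℓ₀y≡))

  Triple : Set
  Triple = Fin (suc m) × Subset (suc m) × Vec (Fin m) m

  Admissible : Triple → Set
  Admissible (x , C , M) = IsMaximal P x × IsChainContaining P x C × IsLinearExtension m (P ∖≼ x) (asMap M)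

  -- The default zero is never used when asMap V is sortable, as its promotion chain is then nonempty.
  decode : Vec (Fin (suc m)) (suc m) → Triple
  decode V = top , fromList chain , restrict (∂ P ℓ) top
    where
    ℓ     = asMap V
    chain = promotionChain P ℓ
    top   = fromMaybe zero (last chain)

  reconstruct : Triple → Vec (Fin (suc m)) (suc m)
  reconstruct (x , C , M) = encode (unpromote (extend x M) C)

  module _ (V : Vec (Fin (suc m)) (suc m)) (sortable : IsSortableLabeling P (asMap V)) where
    open Sortable sortable

    decode-admissible : Admissible (decode V)
    decode-admissible = top-maximal , C-isChain , restrict-isLinearExtension (proj₂ sortable) top-∂

    reconstruct-decode : reconstruct (decode V) ≡ V
    reconstruct-decode = trans (encode-cong λ y →
      trans (unpromote-cong C (extend-restrict (proj₂ sortable) top-∂) y) (sym (ℓ≗unpromote y)))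
      (encode-asMap V)

  module _ (x : Fin (suc m)) (C : Subset (suc m)) (M : Vec (Fin m) m)
           (admissible : Admissible (x , C , M)) where
    private
      D-linExt : IsLinearExtension (suc m) _≼_ (extend x M)
      D-linExt = extend-isLinearExtension (proj₁ admissible) (proj₂ (proj₂ admissible))
      open Unpromote D-linExt (extend-top x M) (proj₁ (proj₂ admissible))

      ℓ : Fin (suc m) → ℕ
      ℓ = asMap (reconstruct (x , C , M))

      ℓ≗ : ∀ y → ℓ y ≡ unpromote (extend x M) C y
      ℓ≗ = asMap-encode unpromote-range

    reconstruct-sortable : IsSortableLabeling P (asMap (reconstruct (x , C , M)))
    reconstruct-sortable = unpromote-sortable ℓ≗

    decode-reconstruct : decode (reconstruct (x , C , M)) ≡ (x , C , M)
    decode-reconstruct = cong₂ _,_ top≡x (cong₂ _,_ (promotionChain-set ℓ≗)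
      (trans (cong (restrict (∂ P ℓ)) top≡x) (trans (encode-cong (∂≗D ℓ≗ ∘ punchIn x)) (restrict-extend x M))))
      where
      top≡x : fromMaybe zero (last (promotionChain P ℓ)) ≡ x
      top≡x = let pre , chain≡ = promotionChain-ends ℓ≗
              in cong (fromMaybe zero) (trans (cong last chain≡) (last-∷ʳ pre x))

  sortables : List (Vec (Fin (suc m)) (suc m))
  sortables = filter (λ V → isSortableLabeling? P (asMap V)) (allMaps (suc m))

  maxima : List (Fin (suc m))
  maxima = filter (isMaximal? P) (allFin (suc m))

  chainsThrough : Fin (suc m) → List (Subset (suc m))
  chainsThrough x = filter (isChainContaining? P x) (vecs (inside ∷ outside ∷ []) (suc m))

  linearExtensionsAvoiding : Fin (suc m) → List (Vec (Fin m) m)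
  linearExtensionsAvoiding x = filter (λ M → isLinearExtension? m (P ∖≼ x) (P ∖≼? x) (asMap M)) (allMaps m)

  triplesAt : Fin (suc m) → List Triple
  triplesAt x = map (x ,′_) (cartesianProduct (chainsThrough x) (linearExtensionsAvoiding x))

  triples : List Triple
  triples = concatMap triplesAt maxima

  length-triples : length triples ≡ sum (map (λ x → #chainsContaining P x * #linExtDelete P x) maxima)
  length-triples = trans (length-concatMap triplesAt maxima) (cong sum (map-cong length-triplesAt maxima))
    where
    length-triplesAt : ∀ x → length (triplesAt x) ≡ #chainsContaining P x * #linExtDelete P x
    length-triplesAt x =
      trans (length-map (x ,′_) (cartesianProduct (chainsThrough x) (linearExtensionsAvoiding x)))
            (length-cartesianProduct (chainsThrough x) (linearExtensionsAvoiding x))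

  ∈-triples⁺ : ∀ {t} → Admissible t → t ∈ triples
  ∈-triples⁺ {x , C , M} (x-max , C-chain , M-linExt) =
    ∈-concatMap⁺′ triplesAt (∈-filter⁺ (isMaximal? P) (∈-allFin x) x-max)
      (∈-map⁺ (x ,′_) (∈-cartesianProduct⁺
        (∈-filter⁺ (isChainContaining? P x) (∈-vecs C (λ i → ∈-inside∷outside (lookup C i))) C-chain)
        (∈-filter⁺ (λ M → isLinearExtension? m (P ∖≼ x) (P ∖≼? x) (asMap M)) (∈-allMaps M) M-linExt)))
    where
    ∈-inside∷outside : ∀ b → b ∈ inside ∷ outside ∷ []
    ∈-inside∷outside true  = here refl
    ∈-inside∷outside false = there (here refl)

  ∈-triples⁻ : ∀ {t} → t ∈ triples → Admissible t
  ∈-triples⁻ t∈ with ∈-concatMap⁻′ triplesAt t∈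
  ... | x , x∈ , t∈triplesAt with ∈-map⁻ (x ,′_) t∈triplesAt
  ...   | (C , M) , CM∈ , refl with ∈-cartesianProduct⁻ (chainsThrough x) (linearExtensionsAvoiding x) CM∈
  ...     | C∈ , M∈ =
    proj₂ (∈-filter⁻ (isMaximal? P) {xs = allFin (suc m)} x∈) ,
    proj₂ (∈-filter⁻ (isChainContaining? P x) {xs = vecs (inside ∷ outside ∷ []) (suc m)} C∈) ,
    proj₂ (∈-filter⁻ (λ M → isLinearExtension? m (P ∖≼ x) (P ∖≼? x) (asMap M)) {xs = allMaps m} M∈)

  triples-unique : Unique triples
  triples-unique = concatMap⁺ triplesAt (Unique.filter⁺ (isMaximal? P) (Unique.allFin⁺ (suc m)))
    (λ x → Unique.map⁺ (cong (proj₂ {B = λ _ → _})) (Unique.cartesianProduct⁺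
      (Unique.filter⁺ (isChainContaining? P x) (vecs⁺ (((λ ()) All.∷ All.[]) ∷ All.[] ∷ []) (suc m)))
      (Unique.filter⁺ _ (allMaps⁺ m))))
    same-first
    where
    same-first : ∀ {a b t} → t ∈ triplesAt a → t ∈ triplesAt b → a ≡ b
    same-first t∈a t∈b with ∈-map⁻ (_ ,′_) t∈a | ∈-map⁻ (_ ,′_) t∈b
    ... | _ , _ , refl | _ , _ , refl = refl

  ∈-sortables⁺ : ∀ V → IsSortableLabeling P (asMap V) → V ∈ sortables
  ∈-sortables⁺ V = ∈-filter⁺ (λ V → isSortableLabeling? P (asMap V)) (∈-allMaps V)

  ∈-sortables⁻ : ∀ {V} → V ∈ sortables → IsSortableLabeling P (asMap V)
  ∈-sortables⁻ V∈ = proj₂ (∈-filter⁻ (λ V → isSortableLabeling? P (asMap V)) {xs = allMaps (suc m)} V∈)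

  decoded-unique : Unique (map decode sortables)
  decoded-unique = map⁺-retraction {g = reconstruct}
    (All.tabulate (λ {V} V∈ → reconstruct-decode V (∈-sortables⁻ V∈)))
    (Unique.filter⁺ _ (allMaps⁺ (suc m)))

  decoded⇔triples : ∀ {t} → t ∈ map decode sortables ⇔ t ∈ triples
  decoded⇔triples = mk⇔ to from
    where
    to : ∀ {t} → t ∈ map decode sortables → t ∈ triples
    to t∈ with ∈-map⁻ decode t∈
    ... | V , V∈ , refl = ∈-triples⁺ (decode-admissible V (∈-sortables⁻ V∈))
    from : ∀ {t} → t ∈ triples → t ∈ map decode sortables
    from {x , C , M} t∈ = subst (_∈ map decode sortables) (decode-reconstruct x C M (∈-triples⁻ t∈))
      (∈-map⁺ decode (∈-sortables⁺ (reconstruct (x , C , M)) (reconstruct-sortable x C M (∈-triples⁻ t∈))))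

theorem4p2 : ∀ {m : ℕ} (P : FinPoset (suc m)) →
    #sortable P
      ≡ sum (map (λ x → #chainsContaining P x * #linExtDelete P x)
                 (filter (isMaximal? P) (allFin (suc m))))
theorem4p2 P = begin
  #sortable P                   ≡⟨ length-map decode sortables ⟨
  length (map decode sortables) ≡⟨ length-unique-≡ decoded-unique triples-unique decoded⇔triples ⟩
  length triples                ≡⟨ length-triples ⟩
  sum (map (λ x → #chainsContaining P x * #linExtDelete P x) maxima) ∎
  where
  open Bijection P
  open ≡-Reasoning
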